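{- Let $\Gamma=(V,E)$ be a strongly connected digraph with diameter $D\ge 2$. Let $X=\{x_1,\ldots,x_r\}\subset V$, $r\ge 2$, be a set of vertices all having the same set of in-neighbors, $Y=\Gamma^{ - }(x_i)$ for $i=1,\ldots,r$, and let $Z=\Gamma^{+}(X)$. Let $\Gamma'$ be a digraph on $V$ obtained from $\Gamma$ by replacing the set $e(X,Z)$ of arcs from $X$ to $Z$ by another set $e'(X,Z)$ of arcs from $X$ to $Z$ (all other arcs unchanged) such that (i) $e'(Y,X)\cap e'(X,Z)=e(Y,X)\cap e(X,Z)$, where $e'(Y,X)$ is the set of arcs from $Y$ to $X$ in $\Gamma'$; and (ii) for the arcs that are not loops, every vertex of $X$ has some out-going arc to a vertex of $Z$ and every vertex of $Z$ has some in-going arc from a vertex of $X$. Assume moreover that every vertex $v\in Z$ has the same number of in-going arcs in $\Gamma'$ as in $\Gamma$, i.e. $|\Gamma'^{ - }(v)|=|\Gamma^{ - }(v)|$ for every $v\in Z$. Let $A$ and $A'$ be the adjacency matrices of $\Gamma$ and $\Gamma'$. Then for every polynomial $p\in\mathbb{R}[x]$ without constant term, written $p(x)=xq(x)$ with $\deg q=\deg p-1$, we have $p(A')=A'q(A)$.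
   Context: For a digraph $\Gamma=(V,E)$, $\Gamma^-(v)$, $\Gamma^+(v)$ denote in- and out-neighborhoods, $\Gamma^+(U)$ is the union of out-neighborhoods of vertices of $U$, and $e(X,Y)$ is the set of arcs from $X$ to $Y$. A loop is an arc from a vertex to itself. The adjacency matrix $A=(a_{uv})$ has $a_{uv}=1$ if $(u,v)$ is an arc and $0$ otherwise. The diameter is the maximum over ordered pairs of vertices of the length of a shortest directed walk between them. -}

module Defs where

open import Level using (Level)
open import Data.Bool using (Bool; true; false; if_then_else_)
open import Data.Nat using (ℕ; zero; suc; _≤_; _<_)
open import Data.Fin using (Fin)
open import Data.Fin.Subset using (Subset; _∈_; ∣_∣)
open import Data.Vec using (tabulate)
open import Data.List using (List; []; _∷_)
open import Data.Product using (Σ; ∃; _×_; _,_)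
open import Relation.Binary.PropositionalEquality using (_≡_)
open import Relation.Nullary using (¬_)
open import Algebra.Bundles using (CommutativeRing)
import Algebra.Properties.Monoid.Sum as MonoidSum

-- A digraph on vertex set Fin n, given by its arc relation:
-- G u v ≡ true  iff  (u , v) is an arc (loops allowed).
Digraph : ℕ → Set
Digraph n = Fin n → Fin n → Bool

module _ {n : ℕ} where

  Walk : Digraph n → ℕ → Fin n → Fin n → Set
  Walk G zero    u v = u ≡ v
  Walk G (suc k) u v = Σ (Fin n) λ w → (G u w ≡ true) × Walk G k w v

  StronglyConnected : Digraph n → Set
  StronglyConnected G = ∀ u v → ∃ λ k → Walk G k u v

  Dist≤ : Digraph n → ℕ → Fin n → Fin n → Set
  Dist≤ G k u v = ∃ λ j → (j ≤ k) × Walk G j u v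

  HasDiameter : Digraph n → ℕ → Set
  HasDiameter G D =
    (∀ u v → Dist≤ G D u v) ×
    (Σ (Fin n) λ u → Σ (Fin n) λ v → ∀ j → j < D → ¬ Walk G j u v)

  InY : Digraph n → Subset n → Fin n → Set
  InY G X y = Σ (Fin n) λ x → (x ∈ X) × (G y x ≡ true)

  InZ : Digraph n → Subset n → Fin n → Set
  InZ G X z = Σ (Fin n) λ x → (x ∈ X) × (G x z ≡ true)

  indeg : Digraph n → Fin n → ℕ
  indeg G v = ∣ tabulate (λ u → G u v) ∣

module Mat {c ℓ : Level} (R : CommutativeRing c ℓ) where
  open CommutativeRing R
  open MonoidSum +-monoid using (sum)

  Matrix : ℕ → Set c
  Matrix n = Fin n → Fin n → Carrier

  _≋_ : {n : ℕ} → Matrix n → Matrix n → Set ℓ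
  M ≋ N = ∀ i j → M i j ≈ N i j

  _⊗_ : {n : ℕ} → Matrix n → Matrix n → Matrix n
  (M ⊗ N) i k = sum (λ j → M i j * N j k)

  _⊕_ : {n : ℕ} → Matrix n → Matrix n → Matrix n
  (M ⊕ N) i j = M i j + N i j

  scalarM : {n : ℕ} → Carrier → Matrix n
  scalarM {n} a i j with i Data.Fin.≟ j
  ... | Relation.Nullary.yes _ = a
  ... | Relation.Nullary.no  _ = 0#

  adj : {n : ℕ} → Digraph n → Matrix n
  adj G u v = if G u v then 1# else 0#

  -- Polynomial with coefficient list (c₀ ∷ c₁ ∷ …) = c₀ + c₁ x + …,
  -- evaluated at a matrix (Horner).
  evalM : {n : ℕ} → List Carrier → Matrix n → Matrix n
  evalM []       M = scalarM 0#
  evalM (a ∷ as) M = scalarM a ⊕ (M ⊗ evalM as M)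

-- Arcs into X are the same in Γ and Γ′: an arc from X into X ∩ Z is kept by (i), and a new one
-- would enlarge the in-neighbourhood of a vertex of Z without changing its in-degree. Hence the
-- columns of A indexed by X are all equal, and so are those of A′; moreover A′ differs from A only
-- in the rows of X, and has the same column sums. So for any M whose columns indexed by X all
-- equal some c,
--   (MA′)ᵤᵥ − (MA)ᵤᵥ = c · Σ_{w ∈ X} (A′ − A)_wv = c · Σ_w (A′ − A)_wv = 0,
-- and MA again has equal columns on X; thus M q(A′) = M q(A) by induction on q. Take M = A′.
module Submission where

open import Defs
open import Level using (Level)
open import Data.Bool using (Bool; true; false; if_then_else_; _≟_)
open import Data.Bool.Properties using (⇔→≡)
open import Data.Nat using (ℕ; zero; suc; _≥_; _<_; s≤s; z≤n)
open import Data.Nat.Properties using (<-irrefl; ≤-trans)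
open import Data.Fin using (Fin)
open import Data.Fin.Properties using (any?)
open import Data.Fin.Subset using (Subset; inside; outside; _∈_; _∉_; _⊆_; Nonempty; ∣_∣)
open import Data.Fin.Subset.Properties using (_∈?_; p⊂q⇒∣p∣<∣q∣)
open import Data.Vec using (_∷_; tabulate; here; there)
open import Data.Vec.Properties using (lookup∘tabulate; lookup⇒[]=; []=⇒lookup; tabulate-cong)
open import Data.List using (List; []; _∷_)
open import Data.Product using (Σ; _×_; _,_; proj₁; proj₂)
open import Relation.Binary.PropositionalEquality as ≡ using (_≡_; _≢_)
open import Relation.Nullary using (¬_; Dec; yes; no; contradiction)
open import Relation.Nullary.Decidable using (_×-dec_)
open import Function using (_∘_)
open import Function.Bundles using (_⇔_; Equivalence; mk⇔)
open import Algebra.Bundles using (CommutativeRing)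
import Algebra.Properties.Semiring.Sum as SemiringSum
import Algebra.Properties.Group as GroupProperties
import Algebra.Definitions.RawMonoid as RawMonoidDefinitions

module MatrixAlgebra {c ℓ : Level} (R : CommutativeRing c ℓ) where
  open CommutativeRing R
  open SemiringSum semiring
  open Mat R
  open GroupProperties +-group using (∙-cancelʳ)
  open RawMonoidDefinitions +-rawMonoid using () renaming (_×_ to _×ₙ_)
  open import Relation.Binary.Reasoning.Setoid setoid

  ≋-refl : ∀ {n} {M : Matrix n} → M ≋ M
  ≋-refl i j = refl

  ⊗-cong : ∀ {n} {M M′ N N′ : Matrix n} → M ≋ M′ → N ≋ N′ → (M ⊗ N) ≋ (M′ ⊗ N′)
  ⊗-cong p q i k = sum-cong-≋ (λ j → *-cong (p i j) (q j k))

  ⊗-distribˡ-⊕ : ∀ {n} (M N P : Matrix n) → (M ⊗ (N ⊕ P)) ≋ ((M ⊗ N) ⊕ (M ⊗ P))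
  ⊗-distribˡ-⊕ M N P i k = trans (sum-cong-≋ (λ j → distribˡ (M i j) (N j k) (P j k)))
                                 (∑-distrib-+ (λ j → M i j * N j k) (λ j → M i j * P j k))

  ⊗-assoc : ∀ {n} (M N P : Matrix n) → ((M ⊗ N) ⊗ P) ≋ (M ⊗ (N ⊗ P))
  ⊗-assoc M N P i l = begin
    sum (λ k → sum (λ j → M i j * N j k) * P k l)
      ≈⟨ sum-cong-≋ (λ k → *-distribʳ-sum (P k l) (λ j → M i j * N j k)) ⟩
    sum (λ k → sum (λ j → M i j * N j k * P k l))
      ≈⟨ ∑-comm (λ k j → M i j * N j k * P k l) ⟩
    sum (λ j → sum (λ k → M i j * N j k * P k l))
      ≈⟨ sum-cong-≋ (λ j → trans (sum-cong-≋ (λ k → *-assoc (M i j) (N j k) (P k l)))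
                                 (sym (*-distribˡ-sum (M i j) (λ k → N j k * P k l)))) ⟩
    sum (λ j → M i j * sum (λ k → N j k * P k l)) ∎

  scalarM-0# : ∀ {n} (i j : Fin n) → scalarM 0# i j ≈ 0#
  scalarM-0# i j with i Data.Fin.≟ j
  ... | yes _ = refl
  ... | no _  = refl

  sum-indicator : ∀ {n} (b : Fin n → Bool) → sum (λ i → if b i then 1# else 0#) ≈ ∣ tabulate b ∣ ×ₙ 1#
  sum-indicator {zero}  b = refl
  sum-indicator {suc n} b with b Fin.zero
  ... | true  = +-congˡ (sum-indicator (λ i → b (Fin.suc i)))
  ... | false = trans (+-identityˡ _) (sum-indicator (λ i → b (Fin.suc i)))

  indicator-cong : ∀ {a b : Bool} → a ≡ b → (if a then 1# else 0#) ≈ (if b then 1# else 0#)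
  indicator-cong a≡b = reflexive (≡.cong (λ b → if b then 1# else 0#) a≡b)

  indeg≡⇒column-sum≈ : ∀ {n} (G G′ : Digraph n) v → indeg G′ v ≡ indeg G v →
                       sum (λ u → adj G′ u v) ≈ sum (λ u → adj G u v)
  indeg≡⇒column-sum≈ G G′ v eq = begin
    sum (λ u → adj G′ u v)  ≈⟨ sum-indicator (λ u → G′ u v) ⟩
    indeg G′ v ×ₙ 1#        ≡⟨ ≡.cong (_×ₙ 1#) eq ⟩
    indeg G v ×ₙ 1#         ≈⟨ sum-indicator (λ u → G u v) ⟨
    sum (λ u → adj G u v)   ∎

  ColumnsAgreeOn : ∀ {n} → Subset n → Matrix n → Set ℓ
  ColumnsAgreeOn X M = ∀ u w w′ → w ∈ X → w′ ∈ X → M u w ≈ M u w′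

  ⊗-columnsAgreeOn : ∀ {n} {X : Subset n} (M : Matrix n) {A : Matrix n} →
                     ColumnsAgreeOn X A → ColumnsAgreeOn X (M ⊗ A)
  ⊗-columnsAgreeOn M agree u w w′ w∈X w′∈X = sum-cong-≋ (λ y → *-congˡ (agree y w w′ w∈X w′∈X))

  module RowPerturbation {n : ℕ} {X : Subset n} {x₀ : Fin n} (x₀∈X : x₀ ∈ X) {A A′ : Matrix n}
           (rows-outside : ∀ w v → w ∉ X → A′ w v ≈ A w v)
           (column-sums : ∀ v → sum (λ w → A′ w v) ≈ sum (λ w → A w v)) where

    ⊗-perturbed : ∀ {M} → ColumnsAgreeOn X M → (M ⊗ A′) ≋ (M ⊗ A)
    ⊗-perturbed {M} agree u v = ∙-cancelʳ (m₀ * sum (λ w → A w v)) _ _ (begin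
        sum (λ w → M u w * A′ w v) + m₀ * sum (λ w → A w v)
          ≈⟨ +-congˡ (*-distribˡ-sum m₀ (λ w → A w v)) ⟩
        sum (λ w → M u w * A′ w v) + sum (λ w → m₀ * A w v)
          ≈⟨ ∑-distrib-+ {n} _ _ ⟨
        sum (λ w → M u w * A′ w v + m₀ * A w v)
          ≈⟨ sum-cong-≋ exchange ⟩
        sum (λ w → M u w * A w v + m₀ * A′ w v)
          ≈⟨ ∑-distrib-+ {n} _ _ ⟩
        sum (λ w → M u w * A w v) + sum (λ w → m₀ * A′ w v)
          ≈⟨ +-congˡ (*-distribˡ-sum m₀ (λ w → A′ w v)) ⟨
        sum (λ w → M u w * A w v) + m₀ * sum (λ w → A′ w v)
          ≈⟨ +-congˡ (*-congˡ (column-sums v)) ⟩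
        sum (λ w → M u w * A w v) + m₀ * sum (λ w → A w v) ∎)
      where
      m₀ : Carrier
      m₀ = M u x₀

      exchange : ∀ w → M u w * A′ w v + m₀ * A w v ≈ M u w * A w v + m₀ * A′ w v
      exchange w with w ∈? X
      ... | yes w∈X = trans (+-cong (*-congʳ (agree u w x₀ w∈X x₀∈X))
                                    (*-congʳ (sym (agree u w x₀ w∈X x₀∈X))))
                            (+-comm _ _)
      ... | no w∉X = +-cong (*-congˡ (rows-outside w v w∉X)) (*-congˡ (sym (rows-outside w v w∉X)))

    ⊗-evalM-perturbed : ColumnsAgreeOn X A → ∀ cs {M} → ColumnsAgreeOn X M →
                        (M ⊗ evalM cs A′) ≋ (M ⊗ evalM cs A)
    ⊗-evalM-perturbed agreeA []       agree = ≋-refl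
    ⊗-evalM-perturbed agreeA (a ∷ cs) {M} agree i k = begin
      (M ⊗ (scalarM a ⊕ (A′ ⊗ evalM cs A′))) i k
        ≈⟨ ⊗-distribˡ-⊕ M (scalarM a) (A′ ⊗ evalM cs A′) i k ⟩
      (M ⊗ scalarM a) i k + (M ⊗ (A′ ⊗ evalM cs A′)) i k
        ≈⟨ +-congˡ (⊗-assoc M A′ (evalM cs A′) i k) ⟨
      (M ⊗ scalarM a) i k + ((M ⊗ A′) ⊗ evalM cs A′) i k
        ≈⟨ +-congˡ (⊗-cong {N = evalM cs A′} (⊗-perturbed agree) ≋-refl i k) ⟩
      (M ⊗ scalarM a) i k + ((M ⊗ A) ⊗ evalM cs A′) i k
        ≈⟨ +-congˡ (⊗-evalM-perturbed agreeA cs (⊗-columnsAgreeOn M agreeA) i k) ⟩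
      (M ⊗ scalarM a) i k + ((M ⊗ A) ⊗ evalM cs A) i k
        ≈⟨ +-congˡ (⊗-assoc M A (evalM cs A) i k) ⟩
      (M ⊗ scalarM a) i k + (M ⊗ (A ⊗ evalM cs A)) i k
        ≈⟨ ⊗-distribˡ-⊕ M (scalarM a) (A ⊗ evalM cs A) i k ⟨
      (M ⊗ (scalarM a ⊕ (A ⊗ evalM cs A))) i k ∎

    evalM-perturbed : ColumnsAgreeOn X A → ColumnsAgreeOn X A′ →
                      ∀ cs → evalM (0# ∷ cs) A′ ≋ (A′ ⊗ evalM cs A)
    evalM-perturbed agreeA agreeA′ cs i k = begin
      scalarM 0# i k + (A′ ⊗ evalM cs A′) i k ≈⟨ +-congʳ (scalarM-0# i k) ⟩
      0# + (A′ ⊗ evalM cs A′) i k             ≈⟨ +-identityˡ _ ⟩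
      (A′ ⊗ evalM cs A′) i k                  ≈⟨ ⊗-evalM-perturbed agreeA cs agreeA′ i k ⟩
      (A′ ⊗ evalM cs A) i k                   ∎

∈-tabulate⁺ : ∀ {n} (f : Fin n → Bool) {i} → f i ≡ true → i ∈ tabulate f
∈-tabulate⁺ f {i} fi = lookup⇒[]= i (tabulate f) (≡.trans (lookup∘tabulate f i) fi)

∈-tabulate⁻ : ∀ {n} (f : Fin n → Bool) {i} → i ∈ tabulate f → f i ≡ true
∈-tabulate⁻ f {i} i∈f = ≡.trans (≡.sym (lookup∘tabulate f i)) ([]=⇒lookup i∈f)

p⊆q∧∣p∣≡∣q∣⇒q⊆p : ∀ {n} {p q : Subset n} → p ⊆ q → ∣ p ∣ ≡ ∣ q ∣ → q ⊆ p
p⊆q∧∣p∣≡∣q∣⇒q⊆p {p = p} p⊆q ∣p∣≡∣q∣ {x} x∈q with x ∈? p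
... | yes x∈p = x∈p
... | no  x∉p = contradiction (p⊂q⇒∣p∣<∣q∣ (p⊆q , x , x∈q , x∉p)) (<-irrefl ∣p∣≡∣q∣)

∣p∣>0⇒Nonempty : ∀ {n} {p : Subset n} → 0 < ∣ p ∣ → Nonempty p
∣p∣>0⇒Nonempty {p = inside  ∷ p} _ = Fin.zero , here
∣p∣>0⇒Nonempty {p = outside ∷ p} ∣p∣>0 with ∣p∣>0⇒Nonempty {p = p} ∣p∣>0
... | x , x∈p = Fin.suc x , there x∈p

column-fixed-by-indeg : ∀ {n} (G G′ : Digraph n) v → (∀ u → G u v ≡ true → G′ u v ≡ true) →
                        indeg G′ v ≡ indeg G v → ∀ u → G′ u v ≡ G u v
column-fixed-by-indeg G G′ v kept indeg≡ u = ⇔→≡ (mk⇔ new⇒old (kept u))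
  where
  new⇒old : G′ u v ≡ true → G u v ≡ true
  new⇒old = ∈-tabulate⁻ (λ w → G w v)
          ∘ p⊆q∧∣p∣≡∣q∣⇒q⊆p (∈-tabulate⁺ (λ w → G′ w v) ∘ kept _ ∘ ∈-tabulate⁻ (λ w → G w v))
                            (≡.sym indeg≡)
          ∘ ∈-tabulate⁺ (λ w → G′ w v)

module Rewiring {n : ℕ} (G G′ : Digraph n) (X : Subset n)
  (same-in-neighbours : ∀ x x′ y → x ∈ X → x′ ∈ X → G y x ≡ G y x′)
  (unchanged : ∀ u v → ¬ (u ∈ X × InZ G X v) → G′ u v ≡ G u v)
  (kept : ∀ u v → (InY G X u × v ∈ X × u ∈ X × InZ G X v × G′ u v ≡ true)
                ⇔ (InY G X u × v ∈ X × u ∈ X × InZ G X v × G u v ≡ true))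
  (indeg-unchanged : ∀ v → InZ G X v → indeg G′ v ≡ indeg G v) where

  InZ? : ∀ v → Dec (InZ G X v)
  InZ? v = any? (λ x → (x ∈? X) ×-dec (G x v ≟ true))

  arcs-into-X-kept : ∀ u x → x ∈ X → G u x ≡ true → G′ u x ≡ true
  arcs-into-X-kept u x x∈X Gux with u ∈? X
  ... | yes u∈X = proj₂ (proj₂ (proj₂ (proj₂ (Equivalence.from (kept u x)
                    ((x , x∈X , Gux) , x∈X , u∈X , (u , u∈X , Gux) , Gux)))))
  ... | no  u∉X = ≡.trans (unchanged u x (u∉X ∘ proj₁)) Gux

  columns-on-X-unchanged : ∀ x → x ∈ X → ∀ u → G′ u x ≡ G u x
  columns-on-X-unchanged x x∈X with InZ? x
  ... | yes x∈Z = column-fixed-by-indeg G G′ x (λ u → arcs-into-X-kept u x x∈X) (indeg-unchanged x x∈Z)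
  ... | no  x∉Z = λ u → unchanged u x (x∉Z ∘ proj₂)

  same-in-neighbours′ : ∀ x x′ y → x ∈ X → x′ ∈ X → G′ y x ≡ G′ y x′
  same-in-neighbours′ x x′ y x∈X x′∈X = begin
    G′ y x  ≡⟨ columns-on-X-unchanged x x∈X y ⟩
    G y x   ≡⟨ same-in-neighbours x x′ y x∈X x′∈X ⟩
    G y x′  ≡⟨ columns-on-X-unchanged x′ x′∈X y ⟨
    G′ y x′ ∎
    where open ≡.≡-Reasoning

  indeg-preserved : ∀ v → indeg G′ v ≡ indeg G v
  indeg-preserved v with InZ? v
  ... | yes v∈Z = indeg-unchanged v v∈Z
  ... | no  v∉Z = ≡.cong ∣_∣ (tabulate-cong (λ u → unchanged u v (v∉Z ∘ proj₂)))

proposition1 : {c ℓ : Level} (R : CommutativeRing c ℓ) (n : ℕ) (G G' : Digraph n) (D : ℕ)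
    → StronglyConnected G → HasDiameter G D → D ≥ 2
    → (X : Subset n) → ∣ X ∣ ≥ 2
    → (∀ x x' y → x ∈ X → x' ∈ X → G y x ≡ G y x')
    → (∀ u v → ¬ (u ∈ X × InZ G X v) → G' u v ≡ G u v)
    → (∀ u v → (InY G X u × v ∈ X × u ∈ X × InZ G X v × G' u v ≡ true)
             ⇔ (InY G X u × v ∈ X × u ∈ X × InZ G X v × G u v ≡ true))
    → (∀ x → x ∈ X → Σ (Fin n) λ z → InZ G X z × z ≢ x × G' x z ≡ true)
    → (∀ z → InZ G X z → Σ (Fin n) λ x → x ∈ X × x ≢ z × G' x z ≡ true)
    → (∀ v → InZ G X v → indeg G' v ≡ indeg G v)
    → (cs : List (CommutativeRing.Carrier R))
    → Mat._≋_ R (Mat.evalM R (CommutativeRing.0# R ∷ cs) (Mat.adj R G'))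
                (Mat._⊗_ R (Mat.adj R G') (Mat.evalM R cs (Mat.adj R G)))
proposition1 R n G G′ _ _ _ _ X ∣X∣≥2 same-in-neighbours unchanged kept _ _ indeg-unchanged =
  RowPerturbation.evalM-perturbed x₀∈X
    (λ w v w∉X → indicator-cong (unchanged w v (w∉X ∘ proj₁)))
    (λ v → indeg≡⇒column-sum≈ G G′ v (indeg-preserved v))
    (λ y w w′ w∈X w′∈X → indicator-cong (same-in-neighbours w w′ y w∈X w′∈X))
    (λ y w w′ w∈X w′∈X → indicator-cong (same-in-neighbours′ w w′ y w∈X w′∈X))
  where
  open MatrixAlgebra R
  open Rewiring G G′ X same-in-neighbours unchanged kept indeg-unchanged

  X-nonempty : Nonempty X
  X-nonempty = ∣p∣>0⇒Nonempty (≤-trans (s≤s z≤n) ∣X∣≥2)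

  x₀∈X : proj₁ X-nonempty ∈ X
  x₀∈X = proj₂ X-nonempty
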